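{- The logic $\mathsf{ITL^p}$ does not have the finite model property; that is, there is a formula that is valid over all finite persistent models but is not in $\mathsf{ITL^p}$.
   Context: Formulas: $\varphi::= p\mid\bot\mid\varphi\wedge\varphi\mid\varphi\vee\varphi\mid\varphi\to\varphi\mid\bigcirc\varphi\mid\Diamond\varphi\mid\Box\varphi$, $p$ in a countable set $\mathbb P$. A model is $(W,\preccurlyeq,S,V)$ with $W\ne\emptyset$, $\preccurlyeq$ a partial order, $S\colon W\to W$ forward confluent ($w\preccurlyeq v\Rightarrow S(w)\preccurlyeq S(v)$), and $V\colon W\to2^{\mathbb P}$ monotone ($w\preccurlyeq v\Rightarrow V(w)\subseteq V(v)$). It is persistent if moreover $S$ is backward confluent: whenever $v\succcurlyeq S(w)$ there is $u\succcurlyeq w$ with $v=S(u)$. Satisfaction, with $S^0(w)=w$, $S^{k+1}(w)=S(S^k(w))$: $w\models p$ iff $p\in V(w)$; $\bot$ never; $\wedge,\vee$ as usual; $w\models\varphi\to\psi$ iff for all $v\succcurlyeq w$, $v\models\varphi$ implies $v\models\psi$; $w\models\bigcirc\varphi$ iff $S(w)\models\varphi$; $w\models\Diamond\varphi$ iff $S^k(w)\models\varphi$ for some $k\ge0$; $w\models\Box\varphi$ iff $S^k(w)\models\varphi$ for all $k\ge 0$. $\mathsf{ITL^p}$ is the set of formulas true at every world of every persistent model. The finite model property for $\mathsf{ITL^p}$ would mean that every formula not in $\mathsf{ITL^p}$ is false at some world of some persistent model with finitely many worlds. -}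

module Defs where

open import Data.Nat using (ℕ; zero; suc)
open import Data.Bool using (Bool; true; false)
open import Data.Fin using (Fin)
open import Data.Product using (Σ; ∃; _×_; _,_)
open import Data.Sum using (_⊎_)
open import Data.Empty using (⊥)
open import Relation.Binary.PropositionalEquality using (_≡_)
open import Relation.Binary.Structures using (IsPartialOrder)
open import Function.Bundles using (_↔_)
open import Relation.Nullary using (¬_)

-- Propositional variables: the countable set ℙ is taken to be ℕ.
Var : Set
Var = ℕ

data Formula : Set where
  var  : Var → Formula
  ⊥'   : Formula
  _∧'_ : Formula → Formula → Formula
  _∨'_ : Formula → Formula → Formula
  _⇒_  : Formula → Formula → Formula
  ○_   : Formula → Formula
  ◇_   : Formula → Formula
  □_   : Formula → Formula

-- A (dynamic intuitionistic) model (W, ≼, S, V).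
-- V : W → 2^ℙ is given as a characteristic function W → ℙ → Bool.
record Model : Set₁ where
  field
    W        : Set
    _≼_      : W → W → Set
    isPO     : IsPartialOrder _≡_ _≼_
    S        : W → W
    S-fwd    : ∀ {w v} → w ≼ v → S w ≼ S v
    V        : W → Var → Bool
    V-mono   : ∀ {w v} p → w ≼ v → V w p ≡ true → V v p ≡ true

  iter : ℕ → W → W
  iter zero    w = w
  iter (suc k) w = S (iter k w)

  _⊨_ : W → Formula → Set
  w ⊨ var p    = V w p ≡ true
  w ⊨ ⊥'       = ⊥
  w ⊨ (φ ∧' ψ) = (w ⊨ φ) × (w ⊨ ψ)
  w ⊨ (φ ∨' ψ) = (w ⊨ φ) ⊎ (w ⊨ ψ)
  w ⊨ (φ ⇒ ψ)  = ∀ v → w ≼ v → v ⊨ φ → v ⊨ ψ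
  w ⊨ (○ φ)    = S w ⊨ φ
  w ⊨ (◇ φ)    = Σ ℕ (λ k → iter k w ⊨ φ)
  w ⊨ (□ φ)    = ∀ k → iter k w ⊨ φ

open Model public

Persistent : Model → Set
Persistent M = ∀ w v → _≼_ M (S M w) v → Σ (W M) (λ u → _≼_ M w u × v ≡ S M u)

FiniteModel : Model → Set
FiniteModel M = Σ ℕ (λ n → W M ↔ Fin n)

ValidIn : Model → Formula → Set
ValidIn M φ = ∀ (w : W M) → _⊨_ M w φ

ITLp : Formula → Set₁
ITLp φ = ∀ (M : Model) → Persistent M → ValidIn M φ

FinPersValid : Formula → Set₁
FinPersValid φ = ∀ (M : Model) → Persistent M → FiniteModel M → ValidIn M φ

-- The witness is the formula  □¬¬p → ¬¬□p.
--
-- In a finite partial order every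
-- point has, up to double negation, a maximal point above it: otherwise,
-- by the double-negation shift over a finite type, we could choose strict
-- successors forever and obtain an infinite strictly ascending chain,
-- which the pigeonhole principle forbids.  Backward confluence makes the
-- successor map S preserve maximality, and at a maximal world ¬¬p already
-- implies p.  Hence above any world satisfying □¬¬p we find (¬¬) a
-- maximal world all of whose S-iterates satisfy p, i.e. a witness of □p.
--
-- On worlds (i , k) ∈ ℕ × ℕ ordered in the first coordinate
-- only, with S (i , k) = (i , k + 1) and p true iff k < i, the formula
-- □¬¬p holds everywhere (raise i), but □p holds nowhere (wait i steps).
module Submission where

open import Defs
  using (Formula; var; ⊥'; _⇒_; □_; Model; Persistent; FinPersValid; ITLp)
open import Data.Product using (Σ; _×_; _,_; proj₁; proj₂)
open import Relation.Nullary using (¬_)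
open import Data.Nat using (ℕ; zero; suc; _+_; _≤_; _<_; _<ᵇ_; z≤n; s≤s)
open import Data.Nat.Properties
  using ( ≤-refl; ≤-trans; ≤-antisym; m≤n⇒m<n∨m≡n; n<1+n; n≤1+n
        ; m≤m+n; m≤n+m; m+n≮m; <ᵇ⇒<; <⇒<ᵇ)
open import Data.Bool using (true)
open import Data.Bool.Properties using (T-≡) renaming (_≟_ to _≟ᵇ_)
open import Data.Fin using (Fin; toℕ) renaming (zero to fzero; suc to fsuc)
open import Data.Fin.Properties using (pigeonhole)
open import Data.Sum using (inj₁; inj₂)
open import Data.Empty using (⊥; ⊥-elim)
open import Function.Bundles using (_↔_; Inverse; Injection; Equivalence)
open import Function.Properties.Inverse using (↔⇒↣)
open import Relation.Nullary.Decidable using (decidable-stable)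
open import Relation.Binary.PropositionalEquality
  using (_≡_; _≢_; refl; sym; cong; subst; isEquivalence)
open import Relation.Binary.Structures using (IsPartialOrder)

¬¬-under-→ : {P Q : Set} → (P → ¬ ¬ Q) → ¬ ¬ (P → Q)
¬¬-under-→ h k = k (λ p → ⊥-elim (h p (λ q → k (λ _ → q))))

¬¬-shift-Fin : ∀ n (P : Fin n → Set) → (∀ i → ¬ ¬ P i) → ¬ ¬ (∀ i → P i)
¬¬-shift-Fin zero    P h k = k (λ ())
¬¬-shift-Fin (suc n) P h k =
  h fzero λ P₀ → ¬¬-shift-Fin n (λ i → P (fsuc i)) (λ i → h (fsuc i)) λ Pₛ →
    k λ { fzero → P₀ ; (fsuc i) → Pₛ i }

¬¬-shift : ∀ {A : Set} {n} → A ↔ Fin n →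
           (P : A → Set) → (∀ x → ¬ ¬ P x) → ¬ ¬ (∀ x → P x)
¬¬-shift finite P h k =
  ¬¬-shift-Fin _ (λ i → P (from i)) (λ i → h (from i))
    (λ all → k (λ x → subst P (strictlyInverseʳ x) (all (to x))))
  where open Inverse finite

module PartialOrder {A : Set} {_⊑_ : A → A → Set} (po : IsPartialOrder _≡_ _⊑_) where

  private module PO = IsPartialOrder po

  _⊏_ : A → A → Set
  x ⊏ y = x ⊑ y × x ≢ y

  -- Maximality in the constructively weak form: everything above is
  -- not-not equal.  (Equality of worlds need not be decidable.)
  Maximal : A → Set
  Maximal m = ∀ y → m ⊑ y → ¬ ¬ (y ≡ m)

  strict-successor : ∀ u → ¬ Maximal u → ¬ ¬ Σ A (u ⊏_)
  strict-successor u not-max none =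
    not-max (λ y u⊑y y≢u → none (y , u⊑y , λ u≡y → y≢u (sym u≡y)))

  module Finite {n : ℕ} (finite : A ↔ Fin n) where

    -- A finite partial order has no infinite strictly ascending chain:
    -- two of the first n + 1 entries coincide, forcing a strict step to
    -- be an equality by antisymmetry.
    no-ascending-chain : (f : ℕ → A) → (∀ k → f k ⊏ f (suc k)) → ⊥
    no-ascending-chain f ascend =
      let i , j , i<j , same = pigeonhole (n<1+n n) (λ i → to (f (toℕ i)))
      in  repeat-free (toℕ i) (toℕ j) i<j (Injection.injective (↔⇒↣ finite) same)
      where
        open Inverse finite using (to)

        rise : ∀ {i j} → i ≤ j → f i ⊑ f j
        rise {j = zero} z≤n = PO.refl
        rise {j = suc j} i≤1+j with m≤n⇒m<n∨m≡n i≤1+j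
        ... | inj₁ (s≤s i≤j) = PO.trans (rise i≤j) (proj₁ (ascend j))
        ... | inj₂ refl      = PO.refl

        repeat-free : ∀ i j → i < j → f i ≢ f j
        repeat-free i j i<j fi≡fj = proj₂ (ascend i)
          (PO.antisym (proj₁ (ascend i)) (subst (f (suc i) ⊑_) (sym fi≡fj) (rise i<j)))

    -- Otherwise the points
    -- with no maximal point above form an upward-closed set in which
    -- every point has a strict successor; choosing them gives an
    -- ascending chain.
    maximal-above : ∀ x → ¬ ¬ Σ A (λ m → x ⊑ m × Maximal m)
    maximal-above x x-unbounded =
      ¬¬-shift finite Step step-possible
        (λ choose → no-ascending-chain (point choose) (ascends choose))
      where
        Unbounded : A → Set
        Unbounded u = ¬ Σ A (λ m → u ⊑ m × Maximal m)

        Step : A → Set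
        Step u = Unbounded u → Σ A (u ⊏_)

        step-possible : ∀ u → ¬ ¬ Step u
        step-possible u =
          ¬¬-under-→ λ unb → strict-successor u (λ max → unb (u , PO.refl , max))

        chain : (∀ u → Step u) → ℕ → Σ A Unbounded
        chain choose zero = x , x-unbounded
        chain choose (suc k) with chain choose k
        ... | u , unb with choose u unb
        ...   | y , u⊑y , _ =
          y , λ { (m , y⊑m , max) → unb (m , PO.trans u⊑y y⊑m , max) }

        point : (∀ u → Step u) → ℕ → A
        point choose k = proj₁ (chain choose k)

        ascends : (choose : ∀ u → Step u) → ∀ k → point choose k ⊏ point choose (suc k)
        ascends choose k with chain choose k
        ... | u , unb = proj₂ (choose u unb)

module _ (M : Model) where
  open Model M
  private module PO = IsPartialOrder isPO
  open PartialOrder isPO using (Maximal)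

  iter-mono : ∀ k {w v} → w ≼ v → iter k w ≼ iter k v
  iter-mono zero    w≼v = w≼v
  iter-mono (suc k) w≼v = S-fwd (iter-mono k w≼v)

  ⇒-up : ∀ {w v} φ ψ → w ≼ v → w ⊨ (φ ⇒ ψ) → v ⊨ (φ ⇒ ψ)
  ⇒-up φ ψ w≼v w⊨φ⇒ψ u v≼u = w⊨φ⇒ψ u (PO.trans w≼v v≼u)

  -- Backward confluence makes S, hence every S^k, preserve maximality.
  maximal-S : Persistent M → ∀ {m} → Maximal m → Maximal (S m)
  maximal-S pers {m} max y Sm≼y with pers m y Sm≼y
  ... | u , m≼u , refl = λ Su≢Sm → max u m≼u (λ u≡m → Su≢Sm (cong S u≡m))

  maximal-iter : Persistent M → ∀ k {m} → Maximal m → Maximal (iter k m)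
  maximal-iter pers zero    max = max
  maximal-iter pers (suc k) max = maximal-S pers (maximal-iter pers k max)

  ¬¬-elim-maximal : ∀ {m} q → Maximal m → m ⊨ ((var q ⇒ ⊥') ⇒ ⊥') → m ⊨ var q
  ¬¬-elim-maximal {m} q max ¬¬q = decidable-stable (V m q ≟ᵇ true) λ ¬q →
    ¬¬q m PO.refl λ y m≼y y⊨q →
      max y m≼y λ y≡m → ¬q (subst (λ z → V z q ≡ true) y≡m y⊨q)

¬' : Formula → Formula
¬' φ = φ ⇒ ⊥'

p : Formula
p = var 0

dns-formula : Formula
dns-formula = (□ (¬' (¬' p))) ⇒ (¬' (¬' (□ p)))

-- Below any world lies (¬¬) a maximal one, where □¬¬p yields □p.
finitely-valid : FinPersValid dns-formula
finitely-valid M pers (_ , finite) _ v _ v⊨□¬¬p v' v≼v' v'⊭□p =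
  maximal-above v' λ { (m , v'≼m , max) →
    v'⊭□p m v'≼m (□p-at m (trans v≼v' v'≼m) max) }
  where
    open Model M
    open IsPartialOrder isPO using (trans)
    open PartialOrder isPO using (Maximal)
    open PartialOrder.Finite isPO finite using (maximal-above)

    □p-at : ∀ m → v ≼ m → Maximal m → ∀ k → iter k m ⊨ p
    □p-at m v≼m max k = ¬¬-elim-maximal M 0 (maximal-iter M pers k max)
      (⇒-up M (¬' p) ⊥' (iter-mono M k v≼m) (v⊨□¬¬p k))

World : Set
World = ℕ × ℕ

_≼ᶜ_ : World → World → Set
(i , k) ≼ᶜ (j , l) = i ≤ j × k ≡ l

≼ᶜ-isPartialOrder : IsPartialOrder _≡_ _≼ᶜ_
≼ᶜ-isPartialOrder = record
  { isPreorder = record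
    { isEquivalence = isEquivalence
    ; reflexive     = λ { refl → ≤-refl , refl }
    ; trans         = λ { (i≤j , refl) (j≤k , refl) → ≤-trans i≤j j≤k , refl }
    }
  ; antisym = λ { (i≤j , refl) (j≤i , _) → cong (_, _) (≤-antisym i≤j j≤i) }
  }

<ᵇ-true⇒< : ∀ m n → (m <ᵇ n) ≡ true → m < n
<ᵇ-true⇒< m n holds = <ᵇ⇒< m n (Equivalence.from T-≡ holds)

<⇒<ᵇ-true : ∀ {m n} → m < n → (m <ᵇ n) ≡ true
<⇒<ᵇ-true m<n = Equivalence.to T-≡ (<⇒<ᵇ m<n)

clock : Model
clock = record
  { W      = World
  ; _≼_    = _≼ᶜ_
  ; isPO   = ≼ᶜ-isPartialOrder
  ; S      = λ { (i , k) → i , suc k }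
  ; S-fwd  = λ { (i≤j , refl) → i≤j , refl }
  ; V      = λ { (i , k) _ → k <ᵇ i }
  ; V-mono = λ { {i , k} _ (i≤j , refl) k<i →
                 <⇒<ᵇ-true (≤-trans (<ᵇ-true⇒< k i k<i) i≤j) }
  }

clock-persistent : Persistent clock
clock-persistent (i , k) (j , _) (i≤j , refl) = (j , k) , (i≤j , refl) , refl

open Model clock using (iter; _⊨_; V)

iter-clock : ∀ k i l → iter k (i , l) ≡ (i , k + l)
iter-clock zero    i l = refl
iter-clock (suc k) i l = cong (λ { (j , m) → j , suc m }) (iter-clock k i l)

-- ¬¬p holds everywhere: any world (j , l) lies below (1 + l + j , l),
-- which satisfies p.
clock-¬¬p : ∀ w → w ⊨ (¬' (¬' p))
clock-¬¬p _ (j , l) (_ , refl) ¬p-above =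
  ¬p-above (suc (l + j) , l) (≤-trans (m≤n+m j l) (n≤1+n (l + j)) , refl)
    (<⇒<ᵇ-true (s≤s (m≤m+n l j)))

-- □p holds nowhere: after j steps from (j , l) the clock reads j + l ≥ j.
clock-¬□p : ∀ w → ¬ (w ⊨ (□ p))
clock-¬□p (j , l) □p =
  m+n≮m j l (<ᵇ-true⇒< (j + l) j
    (subst (λ w → V w 0 ≡ true) (iter-clock j j l) (□p j)))

not-valid : ¬ ITLp dns-formula
not-valid valid =
  valid clock clock-persistent (0 , 0) (0 , 0) (z≤n , refl)
    (λ k → clock-¬¬p (iter k (0 , 0)))
    (0 , 0) (z≤n , refl) (λ w _ → clock-¬□p w)

theorem12 : Σ Formula (λ φ → FinPersValid φ × ¬ ITLp φ)
theorem12 = dns-formula , finitely-valid , not-valid
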